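{- Let $k\ge 1$ and $p_1,\dots,p_k\ge 1$ be integers, let $s_i$ ($1\le i\le k$), $a_{ij}>0$ ($1\le i\le k$, $1\le j\le p_i$) and $\nu$ be integers, and let $r,q$ be positive integers with $\frac{r}{q}=\frac{k-1}{\sum_{i=1}^k p_i}$. Then the sequence $B(n)=\left\lceil \frac{rn}{q}\right\rceil$ formally satisfies the recursion $$R(n)=\sum_{i=1}^k R\Big(n-s_i-\sum_{j=1}^{p_i}R(n-a_{ij})\Big)+\nu$$ for all positive integers $n$ if and only if it formally satisfies it for all $n$ with $0<n\le q^2$.
   Context: A sequence $B$ defined on all integers (here $B(m)=\lceil rm/q\rceil$ for every integer $m$) formally satisfies the recursion at $n$ if replacing every occurrence of $R$ by $B$ yields a true equality, i.e. $B(n)=\sum_{i=1}^k B\big(n-s_i-\sum_{j=1}^{p_i}B(n-a_{ij})\big)+\nu$. This does not require that the recursion generates $B$ from initial conditions. -}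

module Defs where

open import Data.Nat as ℕ using (ℕ; zero; suc; NonZero)
open import Data.Fin using (Fin; zero; suc)
open import Data.Integer as ℤ using (ℤ; +_; -_; _-_; _/ℕ_)
open import Relation.Binary.PropositionalEquality using (_≡_)

Σℤ : (n : ℕ) → (Fin n → ℤ) → ℤ
Σℤ zero    f = + 0
Σℤ (suc n) f = f zero ℤ.+ Σℤ n (λ i → f (suc i))

Σℕ : (n : ℕ) → (Fin n → ℕ) → ℕ
Σℕ zero    f = 0
Σℕ (suc n) f = f zero ℕ.+ Σℕ n (λ i → f (suc i))

-- ceiling division: ⌈ x / q ⌉  (_/ℕ_ is floor division on ℤ)
⌈_/_⌉ : ℤ → (q : ℕ) → .{{NonZero q}} → ℤ
⌈ x / q ⌉ = - ((- x) /ℕ q)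

B : (r q : ℕ) → .{{NonZero q}} → ℤ → ℤ
B r q m = ⌈ (+ r) ℤ.* m / q ⌉

FormallySatisfiesAt : (R : ℤ → ℤ) (k : ℕ) (p : Fin k → ℕ) (s : Fin k → ℤ)
  (a : (i : Fin k) → Fin (p i) → ℤ) (ν : ℤ) (n : ℤ) → Set
FormallySatisfiesAt R k p s a ν n =
  R n ≡ Σℤ k (λ i → R (n - s i - Σℤ (p i) (λ j → R (n - a i j)))) ℤ.+ ν

module Submission where

-- The sequence B(m) = ⌈ r m / q ⌉ has "linear drift": B(m + t q) = B(m) + t r
-- for every integer t.  Feeding this into the recursion shows that shifting
-- n by q² changes
--   * each inner term B(n - a_ij) by q r, so each inner sum by p_i q r,
--   * hence each outer argument by q² - p_i q r = (q - p_i r) q, so each outer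
--     term by (q - p_i r) r, and the whole outer sum by k q r - r² Σ p_i,
--   * while the left-hand side B(n) changes by q r.
-- The hypothesis r Σ p_i = (k - 1) q makes both changes equal, so the set of
-- n at which B formally satisfies the recursion is invariant under
-- translation by multiples of q².  Every n ≥ 1 is such a translate of a
-- representative in [1, q²] (namely 1 + ((n - 1) mod q²)), which gives the
-- nontrivial direction of the theorem.

open import Defs
open import Data.Nat as ℕ using (ℕ; NonZero; _≥_)
open import Data.Fin using (Fin; zero; suc)
open import Data.Integer as ℤ using (ℤ; +_; 1ℤ; _+_; _*_; -_; _-_; _/ℕ_; _≤_; _<_)
import Data.Integer.Properties as ℤP
import Data.Nat.Properties as ℕP
open import Data.Integer.DivMod using ([n/ℕd]*d≤n; n<s[n/ℕd]*d)
open import Data.Nat.DivMod using (_%_; _/_; m≡m%n+[m/n]*n; m%n<n)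
open import Data.Integer.Tactic.RingSolver using (solve-∀)
open import Relation.Binary.PropositionalEquality
  using (_≡_; refl; sym; trans; cong; cong₂; subst; module ≡-Reasoning)
open import Relation.Nullary using (yes; no)
open import Data.Empty using (⊥-elim)
open import Function.Bundles using (_⇔_; mk⇔)
open import Data.Product using (Σ-syntax; _×_; _,_)

open ≡-Reasoning

module Drift (d : ℕ) .{{_ : NonZero d}} where

  quotient-bound : ∀ a b x → a * + d ≤ x → x < (1ℤ + b) * + d → a ≤ b
  quotient-bound a b x ad≤x x<[b+1]d with a ℤ.≤? b
  ... | yes a≤b = a≤b
  ... | no a≰b = ⊥-elim (ℤP.≤⇒≯ [b+1]d≤x x<[b+1]d)
    where
    [b+1]d≤x : (1ℤ + b) * + d ≤ x
    [b+1]d≤x = ℤP.≤-trans (ℤP.*-monoʳ-≤-nonNeg (+ d) (ℤP.i<j⇒suc[i]≤j (ℤP.≰⇒> a≰b))) ad≤x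

  /ℕ-unique : ∀ Q x → Q * + d ≤ x → x < (1ℤ + Q) * + d → x /ℕ d ≡ Q
  /ℕ-unique Q x Qd≤x x<[Q+1]d = ℤP.≤-antisym
    (quotient-bound (x /ℕ d) Q x ([n/ℕd]*d≤n x d) x<[Q+1]d)
    (quotient-bound Q (x /ℕ d) x Qd≤x (n<s[n/ℕd]*d x d))

  /ℕ-drift : ∀ x t → (x + t * + d) /ℕ d ≡ x /ℕ d + t
  /ℕ-drift x t = /ℕ-unique (x /ℕ d + t) (x + t * + d) lower upper
    where
    lower-eq : ∀ Q t D → (Q + t) * D ≡ Q * D + t * D
    lower-eq = solve-∀
    upper-eq : ∀ Q t D → (1ℤ + (Q + t)) * D ≡ (1ℤ + Q) * D + t * D
    upper-eq = solve-∀
    lower : (x /ℕ d + t) * + d ≤ x + t * + d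
    lower = subst (_≤ x + t * + d) (sym (lower-eq (x /ℕ d) t (+ d)))
              (ℤP.+-monoˡ-≤ (t * + d) ([n/ℕd]*d≤n x d))
    upper : x + t * + d < (1ℤ + (x /ℕ d + t)) * + d
    upper = subst (x + t * + d <_) (sym (upper-eq (x /ℕ d) t (+ d)))
              (ℤP.+-monoˡ-< (t * + d) (n<s[n/ℕd]*d x d))

  ⌈/⌉-drift : ∀ x t → ⌈ x + t * + d / d ⌉ ≡ ⌈ x / d ⌉ + t
  ⌈/⌉-drift x t = begin
      - ((- (x + t * + d)) /ℕ d)      ≡⟨ cong (λ z → - (z /ℕ d)) (negate-sum x t (+ d)) ⟩
      - ((- x + (- t) * + d) /ℕ d)    ≡⟨ cong -_ (/ℕ-drift (- x) (- t)) ⟩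
      - ((- x) /ℕ d + - t)            ≡⟨ negate-shift ((- x) /ℕ d) t ⟩
      - ((- x) /ℕ d) + t              ∎
    where
    negate-sum : ∀ x t D → - (x + t * D) ≡ - x + (- t) * D
    negate-sum = solve-∀
    negate-shift : ∀ y t → - (y + - t) ≡ - y + t
    negate-shift = solve-∀

B-drift : ∀ r q .{{_ : NonZero q}} m t → B r q (m + t * + q) ≡ B r q m + t * + r
B-drift r q m t = begin
    ⌈ + r * (m + t * + q) / q ⌉       ≡⟨ cong (λ z → ⌈ z / q ⌉) (distribute (+ r) m t (+ q)) ⟩
    ⌈ + r * m + (t * + r) * + q / q ⌉ ≡⟨ Drift.⌈/⌉-drift q (+ r * m) (t * + r) ⟩
    ⌈ + r * m / q ⌉ + t * + r         ∎
  where
  distribute : ∀ R m t D → R * (m + t * D) ≡ R * m + (t * R) * D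
  distribute = solve-∀

Σℤ-cong : ∀ n {f g : Fin n → ℤ} → (∀ i → f i ≡ g i) → Σℤ n f ≡ Σℤ n g
Σℤ-cong ℕ.zero    f≗g = refl
Σℤ-cong (ℕ.suc n) f≗g = cong₂ _+_ (f≗g zero) (Σℤ-cong n (λ i → f≗g (suc i)))

Σℤ-+ : ∀ n (f g : Fin n → ℤ) → Σℤ n (λ i → f i + g i) ≡ Σℤ n f + Σℤ n g
Σℤ-+ ℕ.zero    f g = refl
Σℤ-+ (ℕ.suc n) f g = begin
    f zero + g zero + Σℤ n (λ i → f (suc i) + g (suc i))
      ≡⟨ cong (_+_ (f zero + g zero)) (Σℤ-+ n (λ i → f (suc i)) (λ i → g (suc i))) ⟩
    f zero + g zero + (Σℤ n (λ i → f (suc i)) + Σℤ n (λ i → g (suc i)))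
      ≡⟨ interchange (f zero) (g zero) (Σℤ n (λ i → f (suc i))) (Σℤ n (λ i → g (suc i))) ⟩
    f zero + Σℤ n (λ i → f (suc i)) + (g zero + Σℤ n (λ i → g (suc i))) ∎
  where
  interchange : ∀ a b S T → a + b + (S + T) ≡ a + S + (b + T)
  interchange = solve-∀

Σℤ-*ʳ : ∀ n (f : Fin n → ℤ) c → Σℤ n (λ i → f i * c) ≡ Σℤ n f * c
Σℤ-*ʳ ℕ.zero    f c = sym (ℤP.*-zeroˡ c)
Σℤ-*ʳ (ℕ.suc n) f c = begin
    f zero * c + Σℤ n (λ i → f (suc i) * c)  ≡⟨ cong (_+_ (f zero * c)) (Σℤ-*ʳ n (λ i → f (suc i)) c) ⟩
    f zero * c + Σℤ n (λ i → f (suc i)) * c  ≡⟨ ℤP.*-distribʳ-+ c (f zero) (Σℤ n (λ i → f (suc i))) ⟨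
    (f zero + Σℤ n (λ i → f (suc i))) * c    ∎

Σℤ-scaled-+ : ∀ n (f g : Fin n → ℤ) t → Σℤ n (λ i → f i + t * g i) ≡ Σℤ n f + t * Σℤ n g
Σℤ-scaled-+ n f g t = begin
  Σℤ n (λ i → f i + t * g i)  ≡⟨ Σℤ-+ n f (λ i → t * g i) ⟩
  Σℤ n f + Σℤ n (λ i → t * g i) ≡⟨ cong (_+_ (Σℤ n f)) (Σℤ-cong n (λ i → ℤP.*-comm t (g i))) ⟩
  Σℤ n f + Σℤ n (λ i → g i * t) ≡⟨ cong (_+_ (Σℤ n f)) (Σℤ-*ʳ n g t) ⟩
  Σℤ n f + Σℤ n g * t           ≡⟨ cong (_+_ (Σℤ n f)) (ℤP.*-comm (Σℤ n g) t) ⟩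
  Σℤ n f + t * Σℤ n g           ∎

Σℤ-pos : ∀ n (p : Fin n → ℕ) → Σℤ n (λ i → + p i) ≡ + Σℕ n p
Σℤ-pos ℕ.zero    p = refl
Σℤ-pos (ℕ.suc n) p = trans (cong (_+_ (+ p zero)) (Σℤ-pos n (λ i → p (suc i))))
                           (sym (ℤP.pos-+ (p zero) (Σℕ n (λ i → p (suc i)))))

Σℤ-weighted : ∀ n (p : Fin n → ℕ) c → Σℤ n (λ i → + p i * c) ≡ + Σℕ n p * c
Σℤ-weighted n p c = trans (Σℤ-*ʳ n (λ i → + p i) c) (cong (_* c) (Σℤ-pos n p))

Σℤ-const : ∀ n c → Σℤ n (λ _ → c) ≡ + n * c
Σℤ-const n c = begin
  Σℤ n (λ _ → c)          ≡⟨ Σℤ-cong n (λ _ → ℤP.*-identityˡ c) ⟨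
  Σℤ n (λ _ → 1ℤ * c)     ≡⟨ Σℤ-weighted n (λ _ → 1) c ⟩
  + Σℕ n (λ _ → 1) * c    ≡⟨ cong (λ m → + m * c) (count n) ⟩
  + n * c                 ∎
  where
  count : ∀ n → Σℕ n (λ _ → 1) ≡ n
  count ℕ.zero    = refl
  count (ℕ.suc n) = cong ℕ.suc (count n)

-- Under r Σ p_i = (k - 1) q with k ≥ 1, the outer drifts (q - p_i r) r add up
-- to exactly q r, the drift of the left-hand side.
outer-drift-total : ∀ k (p : Fin k → ℕ) r q → k ≥ 1 → r ℕ.* Σℕ k p ≡ (k ℕ.∸ 1) ℕ.* q →
  Σℤ k (λ i → (+ q - + p i * + r) * + r) ≡ + q * + r
outer-drift-total k@(ℕ.suc k-1) p r q _ balance = begin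
    Σℤ k (λ i → (+ q - + p i * + r) * + r)
      ≡⟨ Σℤ-cong k (λ i → expand (+ q) (+ p i) (+ r)) ⟩
    Σℤ k (λ i → + q * + r + + p i * - (+ r * + r))
      ≡⟨ Σℤ-+ k (λ _ → + q * + r) (λ i → + p i * - (+ r * + r)) ⟩
    Σℤ k (λ _ → + q * + r) + Σℤ k (λ i → + p i * - (+ r * + r))
      ≡⟨ cong₂ _+_ (Σℤ-const k (+ q * + r)) (Σℤ-weighted k p (- (+ r * + r))) ⟩
    + k * (+ q * + r) + + Σℕ k p * - (+ r * + r)
      ≡⟨ regroup (+ k-1) (+ q) (+ r) (+ Σℕ k p) ⟩
    + q * + r + (+ k-1 * + q - + r * + Σℕ k p) * + r
      ≡⟨ cong (λ z → + q * + r + (+ k-1 * + q - z) * + r) balanceℤ ⟩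
    + q * + r + (+ k-1 * + q - + k-1 * + q) * + r
      ≡⟨ cancel (+ q * + r) (+ k-1 * + q) (+ r) ⟩
    + q * + r ∎
  where
  expand : ∀ Q P R → (Q - P * R) * R ≡ Q * R + P * - (R * R)
  expand = solve-∀
  regroup : ∀ K Q R S → (1ℤ + K) * (Q * R) + S * - (R * R) ≡ Q * R + (K * Q - R * S) * R
  regroup = solve-∀
  cancel : ∀ A X R → A + (X - X) * R ≡ A
  cancel = solve-∀
  balanceℤ : + r * + Σℕ k p ≡ + k-1 * + q
  balanceℤ = trans (sym (ℤP.pos-* r (Σℕ k p))) (trans (cong +_ balance) (ℤP.pos-* k-1 q))

satisfies-translate : ∀ k (p : Fin k → ℕ) s a ν r q .{{_ : NonZero q}} →
  k ≥ 1 → r ℕ.* Σℕ k p ≡ (k ℕ.∸ 1) ℕ.* q →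
  ∀ m t → FormallySatisfiesAt (B r q) k p s a ν m →
          FormallySatisfiesAt (B r q) k p s a ν (m + t * (+ q * + q))
satisfies-translate k p s a ν r q k≥1 balance m t at-m = begin
    Bq (m + t * (Q * Q))                                     ≡⟨ cong Bq (*-assoc-shift t Q) ⟩
    Bq (m + t * Q * Q)                                       ≡⟨ B-drift r q m (t * Q) ⟩
    Bq m + t * Q * R                                         ≡⟨ cong (_+ t * Q * R) at-m ⟩
    Σℤ k outer + ν + t * Q * R                               ≡⟨ move-ν (Σℤ k outer) ν t Q R ⟩
    Σℤ k outer + t * (Q * R) + ν
      ≡⟨ cong (λ z → Σℤ k outer + t * z + ν) (outer-drift-total k p r q k≥1 balance) ⟨
    Σℤ k outer + t * Σℤ k drift + ν                          ≡⟨ cong (_+ ν) (Σℤ-scaled-+ k outer drift t) ⟨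
    Σℤ k (λ i → outer i + t * drift i) + ν                   ≡⟨ cong (_+ ν) (Σℤ-cong k outer-translate) ⟩
    Σℤ k (λ i → Bq (m' - s i - Σℤ (p i) (λ j → Bq (m' - a i j)))) + ν ∎
  where
  Bq : ℤ → ℤ
  Bq = B r q
  Q R m' : ℤ
  Q  = + q
  R  = + r
  m' = m + t * (Q * Q)
  inner outer drift : (i : Fin k) → ℤ
  inner i = Σℤ (p i) (λ j → Bq (m - a i j))
  outer i = Bq (m - s i - inner i)
  drift i = (Q - + p i * R) * R
  *-assoc-shift : ∀ t Q → m + t * (Q * Q) ≡ m + t * Q * Q
  *-assoc-shift t Q = cong (_+_ m) (sym (ℤP.*-assoc t Q Q))
  move-ν : ∀ x y t Q R → x + y + t * Q * R ≡ x + t * (Q * R) + y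
  move-ν = solve-∀
  inner-translate : ∀ i → Σℤ (p i) (λ j → Bq (m' - a i j)) ≡ inner i + + p i * (t * Q * R)
  inner-translate i = begin
      Σℤ (p i) (λ j → Bq (m' - a i j))
        ≡⟨ Σℤ-cong (p i) (λ j → cong Bq (reorder m (a i j) t Q)) ⟩
      Σℤ (p i) (λ j → Bq (m - a i j + t * Q * Q))
        ≡⟨ Σℤ-cong (p i) (λ j → B-drift r q (m - a i j) (t * Q)) ⟩
      Σℤ (p i) (λ j → Bq (m - a i j) + t * Q * R)
        ≡⟨ Σℤ-+ (p i) (λ j → Bq (m - a i j)) (λ _ → t * Q * R) ⟩
      inner i + Σℤ (p i) (λ _ → t * Q * R)
        ≡⟨ cong (_+_ (inner i)) (Σℤ-const (p i) (t * Q * R)) ⟩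
      inner i + + p i * (t * Q * R) ∎
    where
    reorder : ∀ m a t Q → m + t * (Q * Q) - a ≡ m - a + t * Q * Q
    reorder = solve-∀
  -- Hence each outer argument moves by t (q - p_i r) q and each outer term by t drift_i.
  outer-translate : ∀ i → outer i + t * drift i ≡ Bq (m' - s i - Σℤ (p i) (λ j → Bq (m' - a i j)))
  outer-translate i = begin
      outer i + t * drift i
        ≡⟨ cong (_+_ (outer i)) (sym (ℤP.*-assoc t (Q - + p i * R) R)) ⟩
      Bq (m - s i - inner i) + t * (Q - + p i * R) * R
        ≡⟨ B-drift r q (m - s i - inner i) (t * (Q - + p i * R)) ⟨
      Bq (m - s i - inner i + t * (Q - + p i * R) * Q)
        ≡⟨ cong Bq (reorder m (s i) (inner i) (+ p i) t Q R) ⟩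
      Bq (m' - s i - (inner i + + p i * (t * Q * R)))
        ≡⟨ cong (λ z → Bq (m' - s i - z)) (inner-translate i) ⟨
      Bq (m' - s i - Σℤ (p i) (λ j → Bq (m' - a i j))) ∎
    where
    reorder : ∀ m s I P t Q R →
      m - s - I + t * (Q - P * R) * Q ≡ m + t * (Q * Q) - s - (I + P * (t * Q * R))
    reorder = solve-∀

representative : ∀ d .{{_ : NonZero d}} n → n ≥ 1 →
  Σ[ n' ∈ ℕ ] Σ[ t ∈ ℕ ] (n' ≥ 1 × n' ℕ.≤ d × n ≡ n' ℕ.+ t ℕ.* d)
representative d (ℕ.suc n-1) _ =
  ℕ.suc (n-1 % d) , n-1 / d , ℕ.s≤s ℕ.z≤n , m%n<n n-1 d , cong ℕ.suc (m≡m%n+[m/n]*n n-1 d)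

-- The theorem.
theorem1 : (k : ℕ) → k ≥ 1 →
    (p : Fin k → ℕ) → (∀ i → p i ≥ 1) →
    (s : Fin k → ℤ) →
    (a : (i : Fin k) → Fin (p i) → ℤ) → (∀ i j → + 0 ℤ.< a i j) →
    (ν : ℤ) →
    (r q : ℕ) → r ≥ 1 → .{{_ : NonZero q}} →
    r ℕ.* Σℕ k p ≡ (k ℕ.∸ 1) ℕ.* q →
    ((∀ (n : ℕ) → n ≥ 1 → FormallySatisfiesAt (B r q) k p s a ν (+ n))
    ⇔ (∀ (n : ℕ) → n ≥ 1 → n ℕ.≤ q ℕ.* q → FormallySatisfiesAt (B r q) k p s a ν (+ n)))
theorem1 k k≥1 p _ s a _ ν r q _ balance = mk⇔ restrict extend
  where
  Sat : ℤ → Set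
  Sat = FormallySatisfiesAt (B r q) k p s a ν
  restrict : (∀ n → n ≥ 1 → Sat (+ n)) → ∀ n → n ≥ 1 → n ℕ.≤ q ℕ.* q → Sat (+ n)
  restrict all n n≥1 _ = all n n≥1
  extend : (∀ n → n ≥ 1 → n ℕ.≤ q ℕ.* q → Sat (+ n)) → ∀ n → n ≥ 1 → Sat (+ n)
  extend base n n≥1 with representative (q ℕ.* q) {{ℕP.m*n≢0 q q}} n n≥1
  ... | n' , t , n'≥1 , n'≤q² , n≡n'+tq² = subst Sat (sym n≡) translated
    where
    translated : Sat (+ n' + + t * (+ q * + q))
    translated = satisfies-translate k p s a ν r q k≥1 balance (+ n') (+ t) (base n' n'≥1 n'≤q²)
    n≡ : + n ≡ + n' + + t * (+ q * + q)
    n≡ = begin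
      + n                            ≡⟨ cong +_ n≡n'+tq² ⟩
      + (n' ℕ.+ t ℕ.* (q ℕ.* q))     ≡⟨ ℤP.pos-+ n' (t ℕ.* (q ℕ.* q)) ⟩
      + n' + + (t ℕ.* (q ℕ.* q))     ≡⟨ cong (_+_ (+ n')) (ℤP.pos-* t (q ℕ.* q)) ⟩
      + n' + + t * + (q ℕ.* q)       ≡⟨ cong (λ z → + n' + + t * z) (ℤP.pos-* q q) ⟩
      + n' + + t * (+ q * + q)       ∎
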